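{- Let $d \in \{2, 3\}$ and $w \in \mathbb{N}$ with $0 \leq w < 2^{d-1}$. Let $s = (s_0,\dotsc,s_{n-1})$ ($n\ge 0$) and $t = (t_0,\dotsc,t_{m-1})$ ($m \ge 1$) be Boolean input variables with arrival times in $\mathbb{N}$ such that $W(s) = w$ and \[ W(t) \leq 1.9 \cdot \frac{2^{d-1} - w}{d \log_2 (d)} + \frac{d-1}{d} \Lambda_t. \] Then there is a Boolean circuit over $\{\land,\lor\}$ realizing $f(s, t)$ with delay at most $d$.
   Context: For Boolean variables $t = (t_0, \dotsc, t_{m-1})$ with $m \geq 1$, define recursively $g(t) = g^*(t) = t_0$ if $m=1$, and for $m>1$, $g(t) = t_0 \land g^*((t_1, \dotsc, t_{m-1}))$, $g^*(t) = t_0 \lor g((t_1, \dotsc, t_{m-1}))$. For $s = (s_0,\dotsc,s_{n-1})$ (possibly empty), $f(s,t) = s_0 \land \dotsb \land s_{n-1} \land g(t)$. A Boolean circuit over $\{\land,\lor\}$ is a directed acyclic graph whose indegree-0 nodes (inputs) are labeled by Boolean variables, with a unique outdegree-0 node (output) of indegree 1, and all other nodes are gates of indegree exactly 2 labeled \textsc{And} or \textsc{Or}; it realizes a Boolean function if its output computes that function for all input values. Each input variable $x$ has an arrival time $a(x) \in \mathbb{N}$; the delay of input $x$ is $a(x)$ plus the maximum number of gates on any directed path starting at $x$, and the delay of the circuit is the maximum delay over its inputs. The weight of an input is $W(x) = 2^{a(x)}$, and the weight of a tuple of inputs is the sum of the weights of its entries (empty tuple: $0$). For $t = (t_0,\dotsc,t_{m-1})$,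 $\Lambda_t := W(t_0)$ if $m = 1$ and $\Lambda_t := W(t_{m-2}) + W(t_{m-1})$ if $m > 1$. -}

module Defs where

open import Data.Nat using (ℕ; zero; suc; _+_; _^_; _⊔_)
open import Data.Fin using (Fin; zero; suc; fromℕ; inject₁)
open import Data.Bool using (Bool; true; _∧_; _∨_)
open import Data.Sum using (_⊎_; inj₁; inj₂)
open import Data.Product using (_×_; _,_)
open import Relation.Binary.PropositionalEquality using (_≡_)

-- The target Boolean functions.
-- A tuple t = (t_0,…,t_{m}) of length suc m (so m ≥ 1 in the paper's
-- indexing is encoded as length suc m) is a function Fin (suc m) → Bool.

mutual
  g : (m : ℕ) → (Fin (suc m) → Bool) → Bool
  g zero    t = t zero
  g (suc m) t = t zero ∧ g* m (λ i → t (suc i))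

  g* : (m : ℕ) → (Fin (suc m) → Bool) → Bool
  g* zero    t = t zero
  g* (suc m) t = t zero ∨ g m (λ i → t (suc i))

andAll : (n : ℕ) → (Fin n → Bool) → Bool
andAll zero    s = true
andAll (suc n) s = s zero ∧ andAll n (λ i → s (suc i))

f : (n m : ℕ) → (Fin n → Bool) → (Fin (suc m) → Bool) → Bool
f n m s t = andAll n s ∧ g m t

W : (n : ℕ) → (Fin n → ℕ) → ℕ
W zero    a = 0
W (suc n) a = 2 ^ a zero + W n (λ i → a (suc i))

-- Λ_t for t of length suc m:  W(t_0) if length 1,
-- W(t_{len-2}) + W(t_{len-1}) otherwise.
Λ : (m : ℕ) → (Fin (suc m) → ℕ) → ℕ
Λ zero    a = 2 ^ a zero
Λ (suc m) a = 2 ^ a (inject₁ (fromℕ m)) + 2 ^ a (fromℕ (suc m))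

-- Boolean circuits over {∧,∨} as DAGs, presented as straight-line
-- programs (a topological order of the gates).  Gates are referenced de Bruijn
-- style: in a program with k gates, gate `zero` is the most recent one.

data GateType : Set where
  And Or : GateType

Node : Set → ℕ → Set
Node X k = X ⊎ Fin k

data Program (X : Set) : ℕ → Set where
  []  : Program X 0
  _▷_ : {k : ℕ} → Program X k → GateType × Node X k × Node X k →
        Program X (suc k)

record Circuit (X : Set) : Set where
  constructor circuit
  field
    size    : ℕ
    program : Program X size
    output  : Node X size   -- the unique predecessor of the output node

apply : GateType → Bool → Bool → Bool
apply And x y = x ∧ y
apply Or  x y = x ∨ y

mutual
  gateVal : {X : Set} {k : ℕ} → Program X k → (X → Bool) → Fin k → Bool
  gateVal (c ▷ (op , a , b)) ρ zero    = apply op (nodeVal c ρ a) (nodeVal c ρ b)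
  gateVal (c ▷ _)            ρ (suc j) = gateVal c ρ j

  nodeVal : {X : Set} {k : ℕ} → Program X k → (X → Bool) → Node X k → Bool
  nodeVal c ρ (inj₁ x) = ρ x
  nodeVal c ρ (inj₂ j) = gateVal c ρ j

eval : {X : Set} → Circuit X → (X → Bool) → Bool
eval (circuit k c o) ρ = nodeVal c ρ o

Realizes : {X : Set} → Circuit X → ((X → Bool) → Bool) → Set
Realizes C h = ∀ ρ → eval C ρ ≡ h ρ

mutual
  gateDelay : {X : Set} {k : ℕ} → Program X k → (X → ℕ) → Fin k → ℕ
  gateDelay (c ▷ (op , a , b)) α zero    = suc (nodeDelay c α a ⊔ nodeDelay c α b)
  gateDelay (c ▷ _)            α (suc j) = gateDelay c α j

  nodeDelay : {X : Set} {k : ℕ} → Program X k → (X → ℕ) → Node X k → ℕ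
  nodeDelay c α (inj₁ x) = α x
  nodeDelay c α (inj₂ j) = gateDelay c α j

delay : {X : Set} → Circuit X → (X → ℕ) → ℕ
delay (circuit k c o) α = nodeDelay c α o

-- Let x be the excess d·W(t) − (d−1)·Λ_t; the hypothesis says d^(10x) ≤ 2^(19(2^(d−1) − w)),
-- which in each of the six cases for (d, w) forces x ≤ d + 1 and x + w ≤ 4.  As
-- x = W(t) + (d−1)(W(t) − Λ_t), three or more t-inputs would give x ≥ d + 2.  So t has at
-- most two entries, Λ_t = W(t) = x, f(s, t) is the conjunction of all inputs, and their
-- total weight W(s) + W(t) is at most 4 ≤ 2^d.
-- Any conjunction of inputs of total weight at most 2^D has an AND-tree of delay at most D
-- (Kraft's inequality for AND-trees): AND the inputs of arrival time 0 in pairs, then treat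
-- everything as arriving one step later with half the weight, and recurse on D.

module Submission where

open import Defs
open import Data.Nat using (ℕ; zero; suc; _+_; _*_; _∸_; _^_; _≤_; _<_; _⊔_; z≤n; s≤s; s≤s⁻¹; z<s; NonZero)
open import Data.Nat.Properties
open import Data.Fin using (Fin; zero; suc; _↑ˡ_; _↑ʳ_)
open import Data.Bool using (Bool; true; _∧_)
open import Data.Bool.Properties using (∧-assoc; ∧-identityʳ; ∧-commutativeMonoid)
open import Algebra.Bundles using (CommutativeMonoid)
import Algebra.Properties.CommutativeSemigroup as CommutativeSemigroupProperties
open import Data.Sum using (_⊎_; inj₁; inj₂; [_,_]; map₂)
open import Data.Product using (Σ; _×_; _,_; proj₁; proj₂)
open import Data.Maybe using (Maybe; just; nothing; maybe)
open import Data.Maybe.Relation.Unary.All as Maybe using (just; nothing)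
open import Data.List using (List; []; _∷_; _++_; map; tabulate)
open import Data.List.Properties using (map-∘; map-++)
open import Data.List.Relation.Unary.All using (All; []; _∷_; universal)
open import Data.List.Relation.Unary.All.Properties using (map⁺)
open import Data.Empty using (⊥-elim)
open import Data.Bool.ListAction using (and; all)
open import Data.Nat.ListAction using (sum)
open import Data.Nat.ListAction.Properties using (sum-++)
open import Function using (_∘_)
open import Relation.Binary.PropositionalEquality using (_≡_; refl; sym; trans; cong; cong₂; subst; module ≡-Reasoning)

module +-CS = CommutativeSemigroupProperties +-commutativeSemigroup
module ∧-CS = CommutativeSemigroupProperties (CommutativeMonoid.commutativeSemigroup ∧-commutativeMonoid)

2*m≤1+2*n⇒m≤n : ∀ {m n} → 2 * m ≤ suc (2 * n) → m ≤ n
2*m≤1+2*n⇒m≤n {m} {n} h =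
  s≤s⁻¹ (*-cancelˡ-< 2 m (suc n) (≤-trans (s≤s h) (≤-reflexive (sym (*-suc 2 n)))))

^-cancelˡ-< : ∀ b .{{_ : NonZero b}} {x y} → b ^ x < b ^ y → x < y
^-cancelˡ-< b bˣ<bʸ = ≰⇒> (λ y≤x → <⇒≱ bˣ<bʸ (^-monoʳ-≤ b y≤x))

power-bound : ∀ b k .{{_ : NonZero b}} {x y N} → b ^ (k * x) ≤ N → N < b ^ (k * suc y) → x ≤ y
power-bound b k {x} {y} bᵏˣ≤N N<bᵏʸ⁺ᵏ =
  s≤s⁻¹ (*-cancelˡ-< k x (suc y) (^-cancelˡ-< b (≤-<-trans bᵏˣ≤N N<bᵏʸ⁺ᵏ)))

d*w∸[d∸1]*l≡w+[d∸1]*[w∸l] : ∀ {d w l} → 1 ≤ d → l ≤ w → d * w ∸ (d ∸ 1) * l ≡ w + (d ∸ 1) * (w ∸ l)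
d*w∸[d∸1]*l≡w+[d∸1]*[w∸l] {suc c} {w} {l} _ l≤w = begin
  w + c * w ∸ c * l                 ≡⟨ cong (λ x → w + c * x ∸ c * l) (m∸n+n≡m l≤w) ⟨
  w + c * (w ∸ l + l) ∸ c * l       ≡⟨ cong (λ x → w + x ∸ c * l) (*-distribˡ-+ c (w ∸ l) l) ⟩
  w + (c * (w ∸ l) + c * l) ∸ c * l ≡⟨ cong (_∸ c * l) (+-assoc w (c * (w ∸ l)) (c * l)) ⟨
  w + c * (w ∸ l) + c * l ∸ c * l   ≡⟨ m+n∸n≡m (w + c * (w ∸ l)) (c * l) ⟩
  w + c * (w ∸ l)                   ∎
  where open ≡-Reasoning

module _ {X : Set} where

  input : X → Circuit X
  input x = circuit 0 [] (inj₁ x)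

  -- Runs q after p.  Gates are numbered from the most recent one, so q keeps its own
  -- references (↑ˡ) while references into p must skip the l gates of q (↑ʳ).
  infixl 5 _⊕_
  _⊕_ : ∀ {k l} → Program X k → Program X l → Program X (l + k)
  p ⊕ []                 = p
  p ⊕ (q ▷ (op , a , b)) = (p ⊕ q) ▷ (op , map₂ (_↑ˡ _) a , map₂ (_↑ˡ _) b)

  mutual
    gateVal-↑ˡ : ∀ {k l} (p : Program X k) (q : Program X l) ρ j →
                 gateVal (p ⊕ q) ρ (j ↑ˡ k) ≡ gateVal q ρ j
    gateVal-↑ˡ p (q ▷ (op , a , b)) ρ zero    =
      cong₂ (apply op) (nodeVal-↑ˡ p q ρ a) (nodeVal-↑ˡ p q ρ b)
    gateVal-↑ˡ p (q ▷ _)            ρ (suc j) = gateVal-↑ˡ p q ρ j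

    nodeVal-↑ˡ : ∀ {k l} (p : Program X k) (q : Program X l) ρ a →
                 nodeVal (p ⊕ q) ρ (map₂ (_↑ˡ k) a) ≡ nodeVal q ρ a
    nodeVal-↑ˡ p q ρ (inj₁ x) = refl
    nodeVal-↑ˡ p q ρ (inj₂ j) = gateVal-↑ˡ p q ρ j

  gateVal-↑ʳ : ∀ {k l} (p : Program X k) (q : Program X l) ρ j →
               gateVal (p ⊕ q) ρ (l ↑ʳ j) ≡ gateVal p ρ j
  gateVal-↑ʳ p []      ρ j = refl
  gateVal-↑ʳ p (q ▷ _) ρ j = gateVal-↑ʳ p q ρ j

  nodeVal-↑ʳ : ∀ {k l} (p : Program X k) (q : Program X l) ρ a →
               nodeVal (p ⊕ q) ρ (map₂ (l ↑ʳ_) a) ≡ nodeVal p ρ a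
  nodeVal-↑ʳ p q ρ (inj₁ x) = refl
  nodeVal-↑ʳ p q ρ (inj₂ j) = gateVal-↑ʳ p q ρ j

  mutual
    gateDelay-↑ˡ : ∀ {k l} (p : Program X k) (q : Program X l) α j →
                   gateDelay (p ⊕ q) α (j ↑ˡ k) ≡ gateDelay q α j
    gateDelay-↑ˡ p (q ▷ (op , a , b)) α zero    =
      cong suc (cong₂ _⊔_ (nodeDelay-↑ˡ p q α a) (nodeDelay-↑ˡ p q α b))
    gateDelay-↑ˡ p (q ▷ _)            α (suc j) = gateDelay-↑ˡ p q α j

    nodeDelay-↑ˡ : ∀ {k l} (p : Program X k) (q : Program X l) α a →
                   nodeDelay (p ⊕ q) α (map₂ (_↑ˡ k) a) ≡ nodeDelay q α a
    nodeDelay-↑ˡ p q α (inj₁ x) = refl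
    nodeDelay-↑ˡ p q α (inj₂ j) = gateDelay-↑ˡ p q α j

  gateDelay-↑ʳ : ∀ {k l} (p : Program X k) (q : Program X l) α j →
                 gateDelay (p ⊕ q) α (l ↑ʳ j) ≡ gateDelay p α j
  gateDelay-↑ʳ p []      α j = refl
  gateDelay-↑ʳ p (q ▷ _) α j = gateDelay-↑ʳ p q α j

  nodeDelay-↑ʳ : ∀ {k l} (p : Program X k) (q : Program X l) α a →
                 nodeDelay (p ⊕ q) α (map₂ (l ↑ʳ_) a) ≡ nodeDelay p α a
  nodeDelay-↑ʳ p q α (inj₁ x) = refl
  nodeDelay-↑ʳ p q α (inj₂ j) = gateDelay-↑ʳ p q α j

  infixr 6 _∧ᶜ_
  _∧ᶜ_ : Circuit X → Circuit X → Circuit X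
  circuit k p o ∧ᶜ circuit l q o′ =
    circuit _ ((p ⊕ q) ▷ (And , map₂ (l ↑ʳ_) o , map₂ (_↑ˡ k) o′)) (inj₂ zero)

  eval-∧ᶜ : ∀ C C′ ρ → eval (C ∧ᶜ C′) ρ ≡ eval C ρ ∧ eval C′ ρ
  eval-∧ᶜ (circuit k p o) (circuit l q o′) ρ =
    cong₂ _∧_ (nodeVal-↑ʳ p q ρ o) (nodeVal-↑ˡ p q ρ o′)

  delay-∧ᶜ : ∀ C C′ α → delay (C ∧ᶜ C′) α ≡ suc (delay C α ⊔ delay C′ α)
  delay-∧ᶜ (circuit k p o) (circuit l q o′) α =
    cong suc (cong₂ _⊔_ (nodeDelay-↑ʳ p q α o) (nodeDelay-↑ˡ p q α o′))

  -- An entry (C , b) asks for delay C ≤ b + e, with an offset e shared by the whole list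
  -- (see Within); weight is the Kraft sum of these budgets.
  Budgeted : Set
  Budgeted = Circuit X × ℕ

  weight : List Budgeted → ℕ
  weight cs = sum (map (λ (_ , b) → 2 ^ b) cs)

  conj : List Budgeted → (X → Bool) → Bool
  conj cs ρ = all (λ (C , _) → eval C ρ) cs

  weight-∷-pos : ∀ c cs → 0 < weight (c ∷ cs)
  weight-∷-pos (_ , b) cs = ≤-trans (m^n>0 2 b) (m≤m+n _ _)

  -- One halving round: budget-0 entries are ANDed in pairs and all other budgets drop by
  -- one; the Maybe holds a budget-0 entry still waiting for its partner.
  pairUp : Maybe (Circuit X) → List Budgeted → List Budgeted
  pairUp p        ((C , suc b) ∷ cs) = (C , b) ∷ pairUp p cs
  pairUp nothing  []                 = []
  pairUp (just C) []                 = (C , 0) ∷ []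
  pairUp nothing  ((C , zero) ∷ cs)  = pairUp (just C) cs
  pairUp (just C) ((C′ , zero) ∷ cs) = (C ∧ᶜ C′ , 0) ∷ pairUp nothing cs

  pendingVal : Maybe (Circuit X) → (X → Bool) → Bool
  pendingVal p ρ = maybe (λ C → eval C ρ) true p

  pendingWeight : Maybe (Circuit X) → ℕ
  pendingWeight = maybe (λ _ → 1) 0

  conj-pairUp : ∀ p cs ρ → conj (pairUp p cs) ρ ≡ pendingVal p ρ ∧ conj cs ρ
  conj-pairUp p        ((C , suc b) ∷ cs) ρ =
    trans (cong (eval C ρ ∧_) (conj-pairUp p cs ρ))
          (∧-CS.x∙yz≈y∙xz (eval C ρ) (pendingVal p ρ) (conj cs ρ))
  conj-pairUp nothing  []                 ρ = refl
  conj-pairUp (just C) []                 ρ = refl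
  conj-pairUp nothing  ((C , zero) ∷ cs)  ρ = conj-pairUp (just C) cs ρ
  conj-pairUp (just C) ((C′ , zero) ∷ cs) ρ =
    trans (cong₂ _∧_ (eval-∧ᶜ C C′ ρ) (conj-pairUp nothing cs ρ))
          (∧-assoc (eval C ρ) (eval C′ ρ) (conj cs ρ))

  weight-pairUp-lower : ∀ p cs → pendingWeight p + weight cs ≤ 2 * weight (pairUp p cs)
  weight-pairUp-lower p        ((C , suc b) ∷ cs) = begin
    pendingWeight p + (2 * 2 ^ b + weight cs) ≡⟨ +-CS.x∙yz≈y∙xz (pendingWeight p) (2 * 2 ^ b) _ ⟩
    2 * 2 ^ b + (pendingWeight p + weight cs) ≤⟨ +-monoʳ-≤ (2 * 2 ^ b) (weight-pairUp-lower p cs) ⟩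
    2 * 2 ^ b + 2 * weight (pairUp p cs)      ≡⟨ *-distribˡ-+ 2 (2 ^ b) (weight (pairUp p cs)) ⟨
    2 * (2 ^ b + weight (pairUp p cs))        ∎
    where open ≤-Reasoning
  weight-pairUp-lower nothing  []                 = z≤n
  weight-pairUp-lower (just C) []                 = s≤s z≤n
  weight-pairUp-lower nothing  ((C , zero) ∷ cs)  = weight-pairUp-lower (just C) cs
  weight-pairUp-lower (just C) ((C′ , zero) ∷ cs) =
    ≤-trans (s≤s (s≤s (weight-pairUp-lower nothing cs)))
            (≤-reflexive (sym (*-suc 2 (weight (pairUp nothing cs)))))

  weight-pairUp-upper : ∀ p cs → 2 * weight (pairUp p cs) ≤ suc (pendingWeight p + weight cs)
  weight-pairUp-upper p        ((C , suc b) ∷ cs) = begin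
    2 * (2 ^ b + weight (pairUp p cs))              ≡⟨ *-distribˡ-+ 2 (2 ^ b) (weight (pairUp p cs)) ⟩
    2 * 2 ^ b + 2 * weight (pairUp p cs)            ≤⟨ +-monoʳ-≤ (2 * 2 ^ b) (weight-pairUp-upper p cs) ⟩
    2 * 2 ^ b + suc (pendingWeight p + weight cs)   ≡⟨ +-suc (2 * 2 ^ b) _ ⟩
    suc (2 * 2 ^ b + (pendingWeight p + weight cs)) ≡⟨ cong suc (+-CS.x∙yz≈y∙xz (2 * 2 ^ b) (pendingWeight p) _) ⟩
    suc (pendingWeight p + (2 * 2 ^ b + weight cs)) ∎
    where open ≤-Reasoning
  weight-pairUp-upper nothing  []                 = z≤n
  weight-pairUp-upper (just C) []                 = ≤-refl
  weight-pairUp-upper nothing  ((C , zero) ∷ cs)  = weight-pairUp-upper (just C) cs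
  weight-pairUp-upper (just C) ((C′ , zero) ∷ cs) =
    ≤-trans (≤-reflexive (*-suc 2 (weight (pairUp nothing cs))))
            (s≤s (s≤s (weight-pairUp-upper nothing cs)))

  module _ (α : X → ℕ) where

    Within : ℕ → List Budgeted → Set
    Within e = All (λ (C , b) → delay C α ≤ b + e)

    within-pairUp : ∀ {e} p cs → Maybe.All (λ C → delay C α ≤ e) p →
                    Within e cs → Within (suc e) (pairUp p cs)
    within-pairUp {e} p ((C , suc b) ∷ cs) q (d ∷ ds) =
      ≤-trans d (≤-reflexive (sym (+-suc b e))) ∷ within-pairUp p cs q ds
    within-pairUp nothing  []                 nothing  []         = []
    within-pairUp (just C) []                 (just d) []         = m≤n⇒m≤1+n d ∷ []
    within-pairUp nothing  ((C , zero) ∷ cs)  nothing  (d ∷ ds)   = within-pairUp (just C) cs (just d) ds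
    within-pairUp (just C) ((C′ , zero) ∷ cs) (just d) (d′ ∷ ds) =
      ≤-trans (≤-reflexive (delay-∧ᶜ C C′ α)) (s≤s (⊔-lub d d′)) ∷ within-pairUp nothing cs nothing ds

    conj-circuit : ∀ D e cs → Within e cs → 0 < weight cs → weight cs ≤ 2 ^ D →
                   Σ (Circuit X) λ C → (∀ ρ → eval C ρ ≡ conj cs ρ) × delay C α ≤ D + e
    conj-circuit zero e ((C , zero) ∷ [])     (d ∷ []) _ _       = C , (λ ρ → sym (∧-identityʳ (eval C ρ))) , d
    conj-circuit zero e ((C , zero) ∷ c ∷ cs) _        _ (s≤s h) = ⊥-elim (<⇒≱ (weight-∷-pos c cs) h)
    conj-circuit zero e ((C , suc b) ∷ cs)    _        _ h       = ⊥-elim (<⇒≱ 1<weight h)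
      where
      1<weight : 1 < weight ((C , suc b) ∷ cs)
      1<weight = ≤-trans (^-monoʳ-< 2 (n<1+n 1) {0} {suc b} z<s) (m≤m+n (2 ^ suc b) (weight cs))
    conj-circuit (suc D) e cs ds pos h
      with conj-circuit D (suc e) (pairUp nothing cs) (within-pairUp nothing cs nothing ds) pos′ h′
      where
      pos′ : 0 < weight (pairUp nothing cs)
      pos′ = *-cancelˡ-< 2 0 _ (≤-trans pos (weight-pairUp-lower nothing cs))
      -- an unpaired entry rounds the halved weight up, which the even bound 2 ^ suc D absorbs
      h′ : weight (pairUp nothing cs) ≤ 2 ^ D
      h′ = 2*m≤1+2*n⇒m≤n (≤-trans (weight-pairUp-upper nothing cs) (s≤s h))
    ... | C , realizes , fast =
      C , (λ ρ → trans (realizes ρ) (conj-pairUp nothing cs ρ)) , ≤-trans fast (≤-reflexive (+-suc D e))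

    conjunction-circuit : ∀ D (xs : List X) →
                          0 < sum (map (λ x → 2 ^ α x) xs) → sum (map (λ x → 2 ^ α x) xs) ≤ 2 ^ D →
                          Σ (Circuit X) λ C → Realizes C (λ ρ → all ρ xs) × delay C α ≤ D
    conjunction-circuit D xs pos h
      with conj-circuit D 0 (map (λ x → input x , α x) xs)
                        (map⁺ (universal (λ x → m≤m+n (α x) 0) xs))
                        (subst (0 <_) (cong sum (map-∘ xs)) pos)
                        (subst (_≤ 2 ^ D) (cong sum (map-∘ xs)) h)
    ... | C , realizes , fast =
      C , (λ ρ → trans (realizes ρ) (sym (cong and (map-∘ xs)))) , ≤-trans fast (≤-reflexive (+-identityʳ D))

andAll-tabulate : ∀ {X : Set} n (v : Fin n → X) (ρ : X → Bool) → andAll n (ρ ∘ v) ≡ all ρ (tabulate v)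
andAll-tabulate zero    v ρ = refl
andAll-tabulate (suc n) v ρ = cong (ρ (v zero) ∧_) (andAll-tabulate n (v ∘ suc) ρ)

W-tabulate : ∀ {X : Set} n (v : Fin n → X) (α : X → ℕ) →
             W n (α ∘ v) ≡ sum (map (λ x → 2 ^ α x) (tabulate v))
W-tabulate zero    v α = refl
W-tabulate (suc n) v α = cong (2 ^ α (v zero) +_) (W-tabulate n (v ∘ suc) α)

all-++ : ∀ {A : Set} (p : A → Bool) xs ys → all p (xs ++ ys) ≡ all p xs ∧ all p ys
all-++ p []       ys = refl
all-++ p (x ∷ xs) ys =
  trans (cong (p x ∧_) (all-++ p xs ys)) (sym (∧-assoc (p x) (all p xs) (all p ys)))

g≡andAll : ∀ {m} → m ≤ 1 → (t : Fin (suc m) → Bool) → g m t ≡ andAll (suc m) t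
g≡andAll {zero}        _        t = sym (∧-identityʳ (t zero))
g≡andAll {suc zero}    _        t = cong (t zero ∧_) (sym (∧-identityʳ (t (suc zero))))
g≡andAll {suc (suc m)} (s≤s ()) t

inputs : ∀ n m → List (Fin n ⊎ Fin (suc m))
inputs n m = tabulate inj₁ ++ tabulate inj₂

f≡all-inputs : ∀ {n m} → m ≤ 1 → (ρ : Fin n ⊎ Fin (suc m) → Bool) →
               f n m (ρ ∘ inj₁) (ρ ∘ inj₂) ≡ all ρ (inputs n m)
f≡all-inputs {n} {m} m≤1 ρ = begin
  andAll n (ρ ∘ inj₁) ∧ g m (ρ ∘ inj₂)
    ≡⟨ cong (andAll n (ρ ∘ inj₁) ∧_) (g≡andAll m≤1 (ρ ∘ inj₂)) ⟩
  andAll n (ρ ∘ inj₁) ∧ andAll (suc m) (ρ ∘ inj₂)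
    ≡⟨ cong₂ _∧_ (andAll-tabulate n inj₁ ρ) (andAll-tabulate (suc m) inj₂ ρ) ⟩
  all ρ (tabulate inj₁) ∧ all ρ (tabulate inj₂)
    ≡⟨ all-++ ρ (tabulate inj₁) (tabulate inj₂) ⟨
  all ρ (inputs n m)
    ∎
  where open ≡-Reasoning

weight-inputs : ∀ n m (as : Fin n → ℕ) (at : Fin (suc m) → ℕ) →
                sum (map (λ x → 2 ^ [ as , at ] x) (inputs n m)) ≡ W n as + W (suc m) at
weight-inputs n m as at = begin
  sum (map α (tabulate inj₁ ++ tabulate inj₂))
    ≡⟨ cong sum (map-++ α (tabulate inj₁) (tabulate inj₂)) ⟩
  sum (map α (tabulate inj₁) ++ map α (tabulate inj₂))
    ≡⟨ sum-++ (map α (tabulate inj₁)) _ ⟩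
  sum (map α (tabulate inj₁)) + sum (map α (tabulate inj₂))
    ≡⟨ cong₂ _+_ (W-tabulate n inj₁ [ as , at ]) (W-tabulate (suc m) inj₂ [ as , at ]) ⟨
  W n as + W (suc m) at
    ∎
  where
  open ≡-Reasoning
  α : Fin n ⊎ Fin (suc m) → ℕ
  α x = 2 ^ [ as , at ] x

length≤W : ∀ n (a : Fin n → ℕ) → n ≤ W n a
length≤W zero    a = z≤n
length≤W (suc n) a = +-mono-≤ (m^n>0 2 (a zero)) (length≤W n (a ∘ suc))

Λ≤W : ∀ m (a : Fin (suc m) → ℕ) → Λ m a ≤ W (suc m) a
Λ≤W zero          a = m≤m+n _ 0
Λ≤W (suc zero)    a = +-monoʳ-≤ (2 ^ a zero) (m≤m+n _ 0)
Λ≤W (suc (suc m)) a = ≤-trans (Λ≤W (suc m) (a ∘ suc)) (m≤n+m _ (2 ^ a zero))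

Λ≡W : ∀ {m} → m ≤ 1 → (a : Fin (suc m) → ℕ) → Λ m a ≡ W (suc m) a
Λ≡W {zero}        _        a = sym (+-identityʳ _)
Λ≡W {suc zero}    _        a = cong (2 ^ a zero +_) (sym (+-identityʳ _))
Λ≡W {suc (suc m)} (s≤s ()) a

Λ<W : ∀ m (a : Fin (suc (suc (suc m))) → ℕ) → Λ (suc (suc m)) a < W (suc (suc (suc m))) a
Λ<W m a = +-mono-≤ (m^n>0 2 (a zero)) (Λ≤W (suc m) (a ∘ suc))

excess : ℕ → ∀ m → (Fin (suc m) → ℕ) → ℕ
excess d m a = d * W (suc m) a ∸ (d ∸ 1) * Λ m a

excess-short : ∀ {d m} → 1 ≤ d → m ≤ 1 → (a : Fin (suc m) → ℕ) → excess d m a ≡ W (suc m) a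
excess-short {d} {m} 1≤d m≤1 a = begin
  excess d m a                ≡⟨ d*w∸[d∸1]*l≡w+[d∸1]*[w∸l] 1≤d (Λ≤W m a) ⟩
  W′ + (d ∸ 1) * (W′ ∸ Λ m a) ≡⟨ cong (λ l → W′ + (d ∸ 1) * (W′ ∸ l)) (Λ≡W m≤1 a) ⟩
  W′ + (d ∸ 1) * (W′ ∸ W′)    ≡⟨ cong (λ k → W′ + (d ∸ 1) * k) (n∸n≡0 W′) ⟩
  W′ + (d ∸ 1) * 0            ≡⟨ cong (W′ +_) (*-zeroʳ (d ∸ 1)) ⟩
  W′ + 0                      ≡⟨ +-identityʳ W′ ⟩
  W′                          ∎
  where
  open ≡-Reasoning
  W′ = W (suc m) a

excess-long : ∀ {d} m → 1 ≤ d → (a : Fin (suc (suc (suc m))) → ℕ) → suc d < excess d (suc (suc m)) a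
excess-long {suc c} m 1≤d a = begin-strict
  suc (suc c)                           <⟨ +-mono-≤ (≤-trans (m≤m+n 3 m) (length≤W _ a)) c≤c*[W∸Λ] ⟩
  W _ a + c * (W _ a ∸ Λ (suc (suc m)) a) ≡⟨ d*w∸[d∸1]*l≡w+[d∸1]*[w∸l] 1≤d (Λ≤W _ a) ⟨
  excess (suc c) (suc (suc m)) a        ∎
  where
  open ≤-Reasoning
  c≤c*[W∸Λ] : c ≤ c * (W _ a ∸ Λ (suc (suc m)) a)
  c≤c*[W∸Λ] = ≤-trans (≤-reflexive (sym (*-identityʳ c))) (*-monoʳ-≤ c (m<n⇒0<n∸m (Λ<W m a)))

excess≤1+d⇒m≤1 : ∀ {d m} → 1 ≤ d → (a : Fin (suc m) → ℕ) → excess d m a ≤ suc d → m ≤ 1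
excess≤1+d⇒m≤1 {m = zero}        _   a _ = z≤n
excess≤1+d⇒m≤1 {m = suc zero}    _   a _ = ≤-refl
excess≤1+d⇒m≤1 {m = suc (suc m)} 1≤d a h = ⊥-elim (<⇒≱ (excess-long m 1≤d a) h)

bounded-by : ∀ {x w d} B → x ≤ B → B + w ≤ 4 → B ≤ suc d → x + w ≤ 4 × x ≤ suc d
bounded-by {w = w} B x≤B B+w≤4 B≤1+d = ≤-trans (+-monoˡ-≤ w x≤B) B+w≤4 , ≤-trans x≤B B≤1+d

-- B is the largest x the hypothesis allows; every ≤ᵇ⇒≤ is a closed comparison decided by evaluation.
budget : ∀ {d} w x → d ≡ 2 ⊎ d ≡ 3 → w < 2 ^ (d ∸ 1) →
         d ^ (10 * x) ≤ 2 ^ (19 * (2 ^ (d ∸ 1) ∸ w)) → x + w ≤ 4 × x ≤ suc d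
budget 0 x (inj₁ refl) _ h = bounded-by 3 (power-bound 2 10 h (≤ᵇ⇒≤ _ _ _)) (≤ᵇ⇒≤ _ _ _) (≤ᵇ⇒≤ _ _ _)
budget 1 x (inj₁ refl) _ h = bounded-by 1 (power-bound 2 10 h (≤ᵇ⇒≤ _ _ _)) (≤ᵇ⇒≤ _ _ _) (≤ᵇ⇒≤ _ _ _)
budget 0 x (inj₂ refl) _ h = bounded-by 4 (power-bound 3 10 h (≤ᵇ⇒≤ _ _ _)) (≤ᵇ⇒≤ _ _ _) (≤ᵇ⇒≤ _ _ _)
budget 1 x (inj₂ refl) _ h = bounded-by 3 (power-bound 3 10 h (≤ᵇ⇒≤ _ _ _)) (≤ᵇ⇒≤ _ _ _) (≤ᵇ⇒≤ _ _ _)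
budget 2 x (inj₂ refl) _ h = bounded-by 2 (power-bound 3 10 h (≤ᵇ⇒≤ _ _ _)) (≤ᵇ⇒≤ _ _ _) (≤ᵇ⇒≤ _ _ _)
budget 3 x (inj₂ refl) _ h = bounded-by 1 (power-bound 3 10 h (≤ᵇ⇒≤ _ _ _)) (≤ᵇ⇒≤ _ _ _) (≤ᵇ⇒≤ _ _ _)
budget (suc (suc w))             x (inj₁ refl) (s≤s (s≤s ())) _
budget (suc (suc (suc (suc w)))) x (inj₂ refl) (s≤s (s≤s (s≤s (s≤s ())))) _

2≤d : ∀ {d} → d ≡ 2 ⊎ d ≡ 3 → 2 ≤ d
2≤d (inj₁ refl) = ≤-refl
2≤d (inj₂ refl) = n≤1+n 2

lemma3p9 : (d w n m : ℕ) → (d ≡ 2 ⊎ d ≡ 3) → w < 2 ^ (d ∸ 1) →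
           (as : Fin n → ℕ) (at : Fin (suc m) → ℕ) →
           W n as ≡ w →
           d ^ (10 * (d * W (suc m) at ∸ (d ∸ 1) * Λ m at)) ≤ 2 ^ (19 * (2 ^ (d ∸ 1) ∸ w)) →
           Σ (Circuit (Fin n ⊎ Fin (suc m))) (λ C →
             Realizes C (λ ρ → f n m (λ i → ρ (inj₁ i)) (λ j → ρ (inj₂ j)))
             × delay C [ as , at ] ≤ d)
lemma3p9 d w n m d∈ w<2^[d∸1] as at refl hyp =
  let C , realizes , fast = conjunction-circuit [ as , at ] d (inputs n m) positive small
  in  C , (λ ρ → trans (realizes ρ) (sym (f≡all-inputs m≤1 ρ))) , fast
  where
  1≤d : 1 ≤ d
  1≤d = <⇒≤ (2≤d d∈)
  bounds : excess d m at + W n as ≤ 4 × excess d m at ≤ suc d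
  bounds = budget (W n as) (excess d m at) d∈ w<2^[d∸1] hyp
  m≤1 : m ≤ 1
  m≤1 = excess≤1+d⇒m≤1 1≤d at (proj₂ bounds)
  positive : 0 < sum (map (λ x → 2 ^ [ as , at ] x) (inputs n m))
  positive rewrite weight-inputs n m as at =
    ≤-trans (m^n>0 2 (at zero)) (≤-trans (m≤m+n _ _) (m≤n+m _ (W n as)))
  small : sum (map (λ x → 2 ^ [ as , at ] x) (inputs n m)) ≤ 2 ^ d
  small rewrite weight-inputs n m as at | +-comm (W n as) (W (suc m) at) | sym (excess-short 1≤d m≤1 at) =
    ≤-trans (proj₁ bounds) (^-monoʳ-≤ 2 (2≤d d∈))
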